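{- Let $p\ge2$ and let $m_1,\dots,m_p$ be positive integers. For every point $(x_1,\dots,x_p)\in\mathcal{S}^p$, the step length $k(x_1,\dots,x_p)$ equals $2\,\mathrm{lcm}(m_1,\dots,m_p)$; in particular it does not depend on the point.
   Context: $\mathcal{S}^p=\{(x_1,\dots,x_p)\in\mathbb{Z}^p: 0\le x_i\le m_i\}$. For a positive integer $m$ let $\varphi_m(u)=\min_{n\in\mathbb{Z}}|u-2nm|$ for $u\in\mathbb{Z}$. For $k\in\mathbb{Z}$ put $F^k(x_1,\dots,x_p)=(\varphi_{m_1}(x_1+k),\dots,\varphi_{m_p}(x_p+k))$ (the position after $k$ steps of a light beam started in direction $(+1,\dots,+1)$ reflecting in the boundary of $\prod_i[0,m_i]$); in particular $F^{ -1}(x_1,\dots,x_p)=(\varphi_{m_1}(x_1-1),\dots,\varphi_{m_p}(x_p-1))$. The step length $k(x_1,\dots,x_p)$ is the smallest positive integer $k$ with $F^k(x_1,\dots,x_p)=(x_1,\dots,x_p)$ and $F^{k-1}(x_1,\dots,x_p)=F^{ -1}(x_1,\dots,x_p)$. -}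

module Defs where

open import Data.Nat as ℕ using (ℕ; _≤_; _<_)
open import Data.Nat.LCM using (lcm)
open import Data.Integer as ℤ using (ℤ; +_; ∣_∣)
open import Data.Fin using (Fin)
open import Data.Product using (Σ; _×_)
open import Relation.Nullary using (¬_)
open import Relation.Binary.PropositionalEquality using (_≡_)

-- φ_m(u) = min_{n ∈ ℤ} |u - 2 n m|, given as its graph:
-- IsPhi m u d  ⇔  d = φ_m(u)  (d is attained and is a lower bound).
IsPhi : ℕ → ℤ → ℕ → Set
IsPhi m u d =
  Σ ℤ (λ n → ∣ u ℤ.- (+ 2) ℤ.* n ℤ.* (+ m) ∣ ≡ d)
  × (∀ (n : ℤ) → d ≤ ∣ u ℤ.- (+ 2) ℤ.* n ℤ.* (+ m) ∣)

lcmAll : (p : ℕ) → (Fin p → ℕ) → ℕ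
lcmAll ℕ.zero    m = 1
lcmAll (ℕ.suc p) m = lcm (m Fin.zero) (lcmAll p (λ i → m (Fin.suc i)))
  where import Data.Fin as Fin

-- The i-th coordinate of F^k(x) equals the i-th coordinate of F^j(x),
-- i.e. φ_{m_i}(x_i + k) = φ_{m_i}(x_i + j).
SameCoord : ℕ → ℕ → ℤ → ℤ → Set
SameCoord mi xi k j = Σ ℕ (λ d → IsPhi mi (+ xi ℤ.+ k) d × IsPhi mi (+ xi ℤ.+ j) d)

-- F^k(x) = x  and  F^{k-1}(x) = F^{-1}(x)
Returns : (p : ℕ) → (m x : Fin p → ℕ) → ℕ → Set
Returns p m x k =
  (∀ i → IsPhi (m i) (+ x i ℤ.+ + k) (x i))
  × (∀ i → SameCoord (m i) (x i) (+ k ℤ.- ℤ.1ℤ) (ℤ.- ℤ.1ℤ))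

IsStepLength : (p : ℕ) → (m x : Fin p → ℕ) → ℕ → Set
IsStepLength p m x k =
  (0 < k) × Returns p m x k × (∀ j → 0 < j → j < k → ¬ Returns p m x j)

-- A point returns after k steps iff, in every coordinate, φ(x + k) = φ(x) and
-- φ(x + k - 1) = φ(x - 1).  Since φ_m(u) = φ_m(v) exactly when u ≡ ±v (mod 2m),
-- these say x + k ≡ ±x and x + k - 1 ≡ ±(x - 1).  A sign + in either gives 2m ∣ k;
-- the sign − in both gives 2m ∣ (k + 2x) - (k + 2x - 2) = 2, hence again 2m ∣ k.
-- So the return times are the common multiples of the 2m_i, the least being 2 lcm(m_i).
module Submission where

open import Defs
open import Data.Nat using (ℕ; _≤_; _<_; _*_)
open import Data.Fin using (Fin)

open import Data.Nat as ℕ using (suc; _+_; NonZero; >-nonZero)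
import Data.Nat.Properties as ℕP
open import Data.Nat.Divisibility as ℕ∣ using (_∣_)
open import Data.Nat.GCD using (gcd)
open import Data.Nat.LCM using (lcm; lcm-least; m∣lcm[m,n]; n∣lcm[m,n]; gcd*lcm)
open import Data.Fin as Fin using (fromℕ<)
open import Data.Integer as ℤ using (ℤ; +_; +[1+_]; -[1+_]; ∣_∣)
import Data.Integer.Properties as ℤP
import Data.Integer.Divisibility.Signed as ℤ∣
open import Data.Integer.Tactic.RingSolver using (solve-∀; solve)
open import Data.List using (_∷_; [])
open import Data.Product using (Σ; _×_; _,_; proj₁; proj₂)
open import Data.Sum as Sum using (_⊎_; inj₁; inj₂)
open import Function using (_∘_)
open import Relation.Nullary using (¬_)
open import Relation.Binary.PropositionalEquality

∣i∣≡∣j∣⇒i≡j⊎i≡-j : ∀ i j → ∣ i ∣ ≡ ∣ j ∣ → i ≡ j ⊎ i ≡ ℤ.- j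
∣i∣≡∣j∣⇒i≡j⊎i≡-j (+ a)    (+ b)    eq   = inj₁ (cong +_ eq)
∣i∣≡∣j∣⇒i≡j⊎i≡-j (+ a)    -[1+ b ] eq   = inj₂ (cong +_ eq)
∣i∣≡∣j∣⇒i≡j⊎i≡-j -[1+ a ] (+ b)    refl = inj₂ refl
∣i∣≡∣j∣⇒i≡j⊎i≡-j -[1+ a ] -[1+ b ] eq   = inj₁ (cong -[1+_] (ℕP.suc-injective eq))

∣i⊎∣i+2j⇒∣i⊎∣i+2j-2⇒∣i : ∀ {k i j} →
  k ℤ∣.∣ i ⊎ k ℤ∣.∣ i ℤ.+ + 2 ℤ.* j →
  k ℤ∣.∣ i ⊎ k ℤ∣.∣ i ℤ.+ + 2 ℤ.* j ℤ.- + 2 →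
  k ℤ∣.∣ i
∣i⊎∣i+2j⇒∣i⊎∣i+2j-2⇒∣i (inj₁ k∣i) _ = k∣i
∣i⊎∣i+2j⇒∣i⊎∣i+2j-2⇒∣i _ (inj₁ k∣i) = k∣i
∣i⊎∣i+2j⇒∣i⊎∣i+2j-2⇒∣i {k} {i} {j} (inj₂ k∣i+2j) (inj₂ k∣i+2j-2) =
  ℤ∣.∣m+n∣n⇒∣m k∣i+2j (ℤ∣.∣m⇒∣m*n j k∣2)
  where
  k∣2 : k ℤ∣.∣ + 2
  k∣2 = subst (k ℤ∣.∣_) difference (ℤ∣.∣m∣n⇒∣m-n k∣i+2j k∣i+2j-2)
    where
    difference : i ℤ.+ + 2 ℤ.* j ℤ.- (i ℤ.+ + 2 ℤ.* j ℤ.- + 2) ≡ + 2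
    difference = solve (i ∷ j ∷ [])

∣u-aK∣≡∣v-bK∣⇒∣u-v⊎∣u+v : ∀ {K} u v a b → ∣ u ℤ.- a ℤ.* K ∣ ≡ ∣ v ℤ.- b ℤ.* K ∣ →
  K ℤ∣.∣ u ℤ.- v ⊎ K ℤ∣.∣ u ℤ.+ v
∣u-aK∣≡∣v-bK∣⇒∣u-v⊎∣u+v {K} u v a b eq
  with ∣i∣≡∣j∣⇒i≡j⊎i≡-j (u ℤ.- a ℤ.* K) (v ℤ.- b ℤ.* K) eq
... | inj₁ same = inj₁ (ℤ∣.divides (a ℤ.- b) (begin
  u ℤ.- v
    ≡⟨ solve (u ∷ v ∷ a ∷ b ∷ K ∷ []) ⟩
  (u ℤ.- a ℤ.* K) ℤ.- (v ℤ.- b ℤ.* K) ℤ.+ (a ℤ.- b) ℤ.* K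
    ≡⟨ cong (λ w → w ℤ.- (v ℤ.- b ℤ.* K) ℤ.+ (a ℤ.- b) ℤ.* K) same ⟩
  (v ℤ.- b ℤ.* K) ℤ.- (v ℤ.- b ℤ.* K) ℤ.+ (a ℤ.- b) ℤ.* K
    ≡⟨ solve (v ∷ a ∷ b ∷ K ∷ []) ⟩
  (a ℤ.- b) ℤ.* K
    ∎))
  where open ≡-Reasoning
... | inj₂ opposite = inj₂ (ℤ∣.divides (a ℤ.+ b) (begin
  u ℤ.+ v
    ≡⟨ solve (u ∷ v ∷ a ∷ b ∷ K ∷ []) ⟩
  (u ℤ.- a ℤ.* K) ℤ.+ (v ℤ.- b ℤ.* K) ℤ.+ (a ℤ.+ b) ℤ.* K
    ≡⟨ cong (λ w → w ℤ.+ (v ℤ.- b ℤ.* K) ℤ.+ (a ℤ.+ b) ℤ.* K) opposite ⟩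
  ℤ.- (v ℤ.- b ℤ.* K) ℤ.+ (v ℤ.- b ℤ.* K) ℤ.+ (a ℤ.+ b) ℤ.* K
    ≡⟨ solve (v ∷ a ∷ b ∷ K ∷ []) ⟩
  (a ℤ.+ b) ℤ.* K
    ∎))
  where open ≡-Reasoning

IsPhi-shift : ∀ {m u d} t → IsPhi m u d → IsPhi m (u ℤ.+ t ℤ.* (+ 2 ℤ.* + m)) d
IsPhi-shift {m} {u} {d} t ((n , attained) , least) =
  (n ℤ.+ t , trans (cong ∣_∣ (shift-witness u n t (+ m))) attained) ,
  λ n′ → subst (d ≤_) (cong ∣_∣ (sym (shift-witness′ u n′ t (+ m)))) (least (n′ ℤ.- t))
  where
  shift-witness : ∀ u n t M → u ℤ.+ t ℤ.* (+ 2 ℤ.* M) ℤ.- + 2 ℤ.* (n ℤ.+ t) ℤ.* M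
                                ≡ u ℤ.- + 2 ℤ.* n ℤ.* M
  shift-witness = solve-∀
  shift-witness′ : ∀ u n t M → u ℤ.+ t ℤ.* (+ 2 ℤ.* M) ℤ.- + 2 ℤ.* n ℤ.* M
                                 ≡ u ℤ.- + 2 ℤ.* (n ℤ.- t) ℤ.* M
  shift-witness′ = solve-∀

IsPhi-periodic : ∀ {m d} u v → (+ 2 ℤ.* + m) ℤ∣.∣ v ℤ.- u → IsPhi m u d → IsPhi m v d
IsPhi-periodic {m} u v (ℤ∣.divides t v-u≡t*2m) φu =
  subst (λ w → IsPhi m w _) u+[v-u]≡v
    (subst (λ s → IsPhi m (u ℤ.+ s) _) (sym v-u≡t*2m) (IsPhi-shift {m} {u} t φu))
  where
  u+[v-u]≡v : u ℤ.+ (v ℤ.- u) ≡ v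
  u+[v-u]≡v = solve (u ∷ v ∷ [])

IsPhi-neg : ∀ {m u d} → IsPhi m u d → IsPhi m (ℤ.- u) d
IsPhi-neg {m} {u} {d} ((n , attained) , least) =
  (ℤ.- n , trans (∣-∣ (reflect u n (+ m))) attained) ,
  λ n′ → subst (d ≤_) (sym (∣-∣ (reflect′ u n′ (+ m)))) (least (ℤ.- n′))
  where
  ∣-∣ : ∀ {i j} → i ≡ ℤ.- j → ∣ i ∣ ≡ ∣ j ∣
  ∣-∣ {j = j} refl = ℤP.∣-i∣≡∣i∣ j
  reflect : ∀ u n M → ℤ.- u ℤ.- + 2 ℤ.* (ℤ.- n) ℤ.* M ≡ ℤ.- (u ℤ.- + 2 ℤ.* n ℤ.* M)
  reflect = solve-∀
  reflect′ : ∀ u n M → ℤ.- u ℤ.- + 2 ℤ.* n ℤ.* M ≡ ℤ.- (u ℤ.- + 2 ℤ.* (ℤ.- n) ℤ.* M)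
  reflect′ = solve-∀

IsPhi-fixed : ∀ {m y} → y ≤ m → IsPhi m (+ y) y
IsPhi-fixed {m} {y} y≤m = (ℤ.0ℤ , ℕP.+-identityʳ y) , least
  where
  -- A nonzero multiple 2nm is at distance at least 2m - y ≥ y from y.
  far : ∀ n → 0 < ∣ n ∣ → y ≤ ∣ + y ℤ.- + 2 ℤ.* n ℤ.* + m ∣
  far n 0<∣n∣ = ℕP.+-cancelˡ-≤ y y _ (begin
    y + y                               ≤⟨ ℕP.+-mono-≤ y≤m (ℕP.≤-trans y≤m (ℕP.m≤m+n m 0)) ⟩
    2 * m                               ≤⟨ ℕP.*-monoˡ-≤ m (ℕP.*-monoʳ-≤ 2 0<∣n∣) ⟩
    2 * ∣ n ∣ * m                       ≡⟨ sym (trans (ℤP.abs-* (+ 2 ℤ.* n) (+ m))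
                                                   (cong (_* m) (ℤP.abs-* (+ 2) n))) ⟩
    ∣ + 2 ℤ.* n ℤ.* + m ∣               ≡⟨ cong ∣_∣ (split (+ y) (+ 2 ℤ.* n ℤ.* + m)) ⟩
    ∣ + y ℤ.+ ℤ.- (+ y ℤ.- + 2 ℤ.* n ℤ.* + m) ∣
                                        ≤⟨ ℤP.∣i+j∣≤∣i∣+∣j∣ (+ y) (ℤ.- y-2nm) ⟩
    y + ∣ ℤ.- (+ y ℤ.- + 2 ℤ.* n ℤ.* + m) ∣
                                        ≡⟨ cong (λ a → y + a) (ℤP.∣-i∣≡∣i∣ y-2nm) ⟩
    y + ∣ + y ℤ.- + 2 ℤ.* n ℤ.* + m ∣  ∎)
    where
    open ℕP.≤-Reasoning
    y-2nm : ℤ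
    y-2nm = + y ℤ.- + 2 ℤ.* n ℤ.* + m
    split : ∀ a b → b ≡ a ℤ.+ ℤ.- (a ℤ.- b)
    split = solve-∀

  least : ∀ n → y ≤ ∣ + y ℤ.- + 2 ℤ.* n ℤ.* + m ∣
  least (+ 0)          = ℕP.≤-reflexive (sym (ℕP.+-identityʳ y))
  least n@(+[1+ _ ])   = far n ℕ.z<s
  least n@(-[1+ _ ])   = far n ℕ.z<s

IsPhi-pred : ∀ {m x} → 0 < m → x ≤ m → Σ ℕ (IsPhi m (+ x ℤ.+ ℤ.- ℤ.1ℤ))
IsPhi-pred {m} {0} 0<m _ = 1 , IsPhi-neg {m} {+ 1} (IsPhi-fixed 0<m)
IsPhi-pred {m} {suc x} _ 1+x≤m = x , IsPhi-fixed (ℕP.≤-trans (ℕP.n≤1+n x) 1+x≤m)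

IsPhi-same⇒∣u-v⊎∣u+v : ∀ {m d} u v → IsPhi m u d → IsPhi m v d →
  (+ 2 ℤ.* + m) ℤ∣.∣ u ℤ.- v ⊎ (+ 2 ℤ.* + m) ℤ∣.∣ u ℤ.+ v
IsPhi-same⇒∣u-v⊎∣u+v {m} u v ((n , φu) , _) ((n′ , φv) , _) =
  ∣u-aK∣≡∣v-bK∣⇒∣u-v⊎∣u+v u v n n′ (begin
    ∣ u ℤ.- n ℤ.* (+ 2 ℤ.* + m) ∣    ≡⟨ cong ∣_∣ (offset u n (+ m)) ⟨
    ∣ u ℤ.- + 2 ℤ.* n ℤ.* + m ∣      ≡⟨ trans φu (sym φv) ⟩
    ∣ v ℤ.- + 2 ℤ.* n′ ℤ.* + m ∣     ≡⟨ cong ∣_∣ (offset v n′ (+ m)) ⟩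
    ∣ v ℤ.- n′ ℤ.* (+ 2 ℤ.* + m) ∣   ∎)
  where
  open ≡-Reasoning
  offset : ∀ u n M → u ℤ.- + 2 ℤ.* n ℤ.* M ≡ u ℤ.- n ℤ.* (+ 2 ℤ.* M)
  offset = solve-∀

x+j-x≡j : ∀ x j → x ℤ.+ j ℤ.- x ≡ j
x+j-x≡j = solve-∀

x+[j-1]-[x-1]≡j : ∀ x j → x ℤ.+ (j ℤ.- ℤ.1ℤ) ℤ.- (x ℤ.+ ℤ.- ℤ.1ℤ) ≡ j
x+[j-1]-[x-1]≡j = solve-∀

returns-coord⇒2m∣ : ∀ {m x} j → x ≤ m → IsPhi m (+ x ℤ.+ j) x →
  SameCoord m x (j ℤ.- ℤ.1ℤ) (ℤ.- ℤ.1ℤ) → (+ 2 ℤ.* + m) ℤ∣.∣ j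
returns-coord⇒2m∣ {m} {x} j x≤m φ[x+j] (_ , φ[x+j-1] , φ[x-1]) =
  ∣i⊎∣i+2j⇒∣i⊎∣i+2j-2⇒∣i {j = + x}
    (Sum.map (subst M∣_ (x+j-x≡j (+ x) j)) (subst M∣_ (x+j+x≡j+2x (+ x) j))
      (IsPhi-same⇒∣u-v⊎∣u+v (+ x ℤ.+ j) (+ x) φ[x+j] (IsPhi-fixed x≤m)))
    (Sum.map (subst M∣_ (x+[j-1]-[x-1]≡j (+ x) j))
             (subst M∣_ (x+[j-1]+[x-1]≡j+2x-2 (+ x) j))
      (IsPhi-same⇒∣u-v⊎∣u+v (+ x ℤ.+ (j ℤ.- ℤ.1ℤ)) (+ x ℤ.+ ℤ.- ℤ.1ℤ) φ[x+j-1] φ[x-1]))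
  where
  M∣_ : ℤ → Set
  M∣_ = (+ 2 ℤ.* + m) ℤ∣.∣_
  x+j+x≡j+2x : ∀ x j → x ℤ.+ j ℤ.+ x ≡ j ℤ.+ + 2 ℤ.* x
  x+j+x≡j+2x = solve-∀
  x+[j-1]+[x-1]≡j+2x-2 : ∀ x j →
    x ℤ.+ (j ℤ.- ℤ.1ℤ) ℤ.+ (x ℤ.+ ℤ.- ℤ.1ℤ) ≡ j ℤ.+ + 2 ℤ.* x ℤ.- + 2
  x+[j-1]+[x-1]≡j+2x-2 = solve-∀

2m∣⇒returns-coord : ∀ {m x} k → 0 < m → x ≤ m → (+ 2 ℤ.* + m) ℤ∣.∣ + k →
  IsPhi m (+ x ℤ.+ + k) x × SameCoord m x (+ k ℤ.- ℤ.1ℤ) (ℤ.- ℤ.1ℤ)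
2m∣⇒returns-coord {m} {x} k 0<m x≤m 2m∣k with IsPhi-pred 0<m x≤m
... | d , φ[x-1] =
  IsPhi-periodic (+ x) (+ x ℤ.+ + k) (subst M∣_ (sym (x+j-x≡j (+ x) (+ k))) 2m∣k)
    (IsPhi-fixed x≤m) ,
  d , IsPhi-periodic (+ x ℤ.+ ℤ.- ℤ.1ℤ) (+ x ℤ.+ (+ k ℤ.- ℤ.1ℤ))
        (subst M∣_ (sym (x+[j-1]-[x-1]≡j (+ x) (+ k))) 2m∣k) φ[x-1] ,
      φ[x-1]
  where
  M∣_ : ℤ → Set
  M∣_ = (+ 2 ℤ.* + m) ℤ∣.∣_

toℤ-2m∣ : ∀ {m k} → 2 * m ∣ k → (+ 2 ℤ.* + m) ℤ∣.∣ + k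
toℤ-2m∣ {m} {k} 2m∣k = subst (ℤ∣._∣ + k) (ℤP.pos-* 2 m) (ℤ∣.∣ᵤ⇒∣ 2m∣k)

fromℤ-2m∣ : ∀ {m k} → (+ 2 ℤ.* + m) ℤ∣.∣ + k → 2 * m ∣ k
fromℤ-2m∣ {m} {k} 2m∣k = ℤ∣.∣⇒∣ᵤ (subst (ℤ∣._∣ + k) (sym (ℤP.pos-* 2 m)) 2m∣k)

returns⇒2m∣ : ∀ {p m x j} → (∀ i → x i ≤ m i) → Returns p m x j → ∀ i → 2 * m i ∣ j
returns⇒2m∣ {m = m} {j = j} x≤m (back , same) i =
  fromℤ-2m∣ {m i} (returns-coord⇒2m∣ (+ j) (x≤m i) (back i) (same i))

2m∣⇒returns : ∀ {p m x k} → (∀ i → 0 < m i) → (∀ i → x i ≤ m i) → (∀ i → 2 * m i ∣ k) →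
  Returns p m x k
2m∣⇒returns {m = m} {x} {k} 0<m x≤m 2m∣k =
  (λ i → proj₁ (coord i)) , (λ i → proj₂ (coord i))
  where
  coord : ∀ i → IsPhi (m i) (+ x i ℤ.+ + k) (x i)
              × SameCoord (m i) (x i) (+ k ℤ.- ℤ.1ℤ) (ℤ.- ℤ.1ℤ)
  coord i = 2m∣⇒returns-coord k (0<m i) (x≤m i) (toℤ-2m∣ {m i} (2m∣k i))

m∣lcmAll : ∀ p (m : Fin p → ℕ) i → m i ∣ lcmAll p m
m∣lcmAll (suc p) m Fin.zero    = m∣lcm[m,n] (m Fin.zero) (lcmAll p (m ∘ Fin.suc))
m∣lcmAll (suc p) m (Fin.suc i) =
  ℕ∣.∣-trans (m∣lcmAll p (m ∘ Fin.suc) i) (n∣lcm[m,n] (m Fin.zero) (lcmAll p (m ∘ Fin.suc)))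

lcmAll-least : ∀ p (m : Fin p → ℕ) {c} → (∀ i → m i ∣ c) → lcmAll p m ∣ c
lcmAll-least ℕ.zero  m {c} _   = ℕ∣.1∣ c
lcmAll-least (suc p) m     m∣c =
  lcm-least (m∣c Fin.zero) (lcmAll-least p (m ∘ Fin.suc) (m∣c ∘ Fin.suc))

lcm-pos : ∀ {m n} → 0 < m → 0 < n → 0 < lcm m n
lcm-pos {m} {n} 0<m 0<n = ℕP.n≢0⇒n>0 λ lcm≡0 →
  Sum.[ ℕP.n>0⇒n≢0 0<m , ℕP.n>0⇒n≢0 0<n ] (ℕP.m*n≡0⇒m≡0∨n≡0 m (begin
    m * n               ≡⟨ gcd*lcm m n ⟨
    gcd m n * lcm m n   ≡⟨ cong (gcd m n *_) lcm≡0 ⟩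
    gcd m n * 0         ≡⟨ ℕP.*-zeroʳ (gcd m n) ⟩
    0                   ∎))
  where open ≡-Reasoning

lcmAll-pos : ∀ p (m : Fin p → ℕ) → (∀ i → 0 < m i) → 0 < lcmAll p m
lcmAll-pos ℕ.zero  m _   = ℕ.z<s
lcmAll-pos (suc p) m 0<m = lcm-pos (0<m Fin.zero) (lcmAll-pos p (m ∘ Fin.suc) (0<m ∘ Fin.suc))

*-lcmAll-least : ∀ {p} → Fin p → ∀ k (m : Fin p → ℕ) {c} .{{_ : NonZero k}} →
  (∀ i → k * m i ∣ c) → k * lcmAll p m ∣ c
*-lcmAll-least {p} i₀ k m {c} km∣c = subst (k * lcmAll p m ∣_) (sym c≡k*c′)
  (ℕ∣.*-monoʳ-∣ k (lcmAll-least p m m∣c′))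
  where
  k∣c : k ∣ c
  k∣c = ℕ∣.∣-trans (ℕ∣.m∣m*n (m i₀)) (km∣c i₀)
  c′ : ℕ
  c′ = ℕ∣.quotient k∣c
  c≡k*c′ : c ≡ k * c′
  c≡k*c′ = trans (ℕ∣._∣_.equality k∣c) (ℕP.*-comm c′ k)
  m∣c′ : ∀ i → m i ∣ c′
  m∣c′ i = ℕ∣.*-cancelˡ-∣ k (subst (k * m i ∣_) c≡k*c′ (km∣c i))

theorem4p8 : (p : ℕ) → 2 ≤ p → (m : Fin p → ℕ) → (∀ i → 0 < m i) →
    (x : Fin p → ℕ) → (∀ i → x i ≤ m i) →
    IsStepLength p m x (2 * lcmAll p m)
theorem4p8 p 2≤p m 0<m x x≤m =
  ℕP.*-monoʳ-< 2 (lcmAll-pos p m 0<m) ,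
  2m∣⇒returns 0<m x≤m (λ i → ℕ∣.*-monoʳ-∣ 2 (m∣lcmAll p m i)) ,
  minimal
  where
  i₀ : Fin p
  i₀ = fromℕ< (ℕP.<⇒≤ 2≤p)
  minimal : ∀ j → 0 < j → j < 2 * lcmAll p m → ¬ Returns p m x j
  minimal j 0<j j<2L returns = ℕP.<⇒≱ j<2L
    (ℕ∣.∣⇒≤ {{>-nonZero 0<j}} (*-lcmAll-least i₀ 2 m (returns⇒2m∣ x≤m returns)))
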